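{- Let $H=(\mathcal{V},\mathcal{I})$ be an interval hypergraph and let $\mathcal{P}=\{S_1,\dots,S_k\}$ be a partition of $\mathcal{I}$ such that each $S_i$ has an exact hitting set $h_i\subseteq\mathcal{V}$ (i.e. $|I\cap h_i|=1$ for all $I\in S_i$). Let $R=\bigcup_{i=1}^k h_i$ and define $t:\mathcal{I}\to\mathcal{V}$ by letting $t(I)$ be the unique element of $I\cap h_i$, where $S_i$ is the part containing $I$. Then the clique number of the co-occurrence graph $G_{R,t}$ is at most $k$.
   Context: An interval hypergraph is $H=(\mathcal{V},\mathcal{I})$ with $\mathcal{V}=[n]$ and $\mathcal{I}$ a set of intervals $\{i,\dots,j\}\subseteq[n]$. For a map $t:\mathcal{I}\to\mathcal{V}$ with $t(I)\in I$ and $R=t(\mathcal{I})$, the co-occurrence graph $G_{R,t}$ has vertex set $R$, with distinct $u,v$ adjacent iff some $I\in\mathcal{I}$ has $u,v\in I$ and $t(I)\in\{u,v\}$. -}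

module Defs where

open import Data.Nat using (ℕ)
open import Data.Fin using (Fin; _≤_)
open import Data.Fin.Subset using (Subset; _∈_)
open import Data.Product using (_×_; ∃; ∃!; proj₁; proj₂)
open import Data.Sum using (_⊎_)
open import Data.List using (List)
open import Data.List.Relation.Unary.All using (All)
open import Data.List.Relation.Unary.AllPairs using (AllPairs)
open import Relation.Binary.PropositionalEquality using (_≡_; _≢_)
open import Function.Definitions using (Injective; Surjective)

-- Vertex set [n] is represented as Fin n (vertex i+1 ↔ i).
-- An interval {a,…,b} is represented by its endpoints (a , b) with a ≤ b.
Interval : ℕ → Set
Interval n = Fin n × Fin n

_∈I_ : ∀ {n} → Fin n → Interval n → Set
v ∈I I = (proj₁ I ≤ v) × (v ≤ proj₂ I)

-- An interval hypergraph on [n] with m hyperedges: an injective family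
-- of (nonempty) intervals, i.e. the set 𝓘 = { ivs j | j : Fin m }.
record IntervalHypergraph (n m : ℕ) : Set where
  field
    ivs       : Fin m → Interval n
    wellForm  : ∀ j → proj₁ (ivs j) ≤ proj₂ (ivs j)
    distinct  : Injective _≡_ _≡_ ivs

Adj : ∀ {n m} → IntervalHypergraph n m → (Fin m → Fin n) → Fin n → Fin n → Set
Adj H t u v = (u ≢ v) × ∃ λ j →
  (u ∈I IntervalHypergraph.ivs H j) × (v ∈I IntervalHypergraph.ivs H j) × ((t j ≡ u) ⊎ (t j ≡ v))

IsClique : ∀ {n m} → IntervalHypergraph n m → (Fin n → Set) → (Fin m → Fin n) → List (Fin n) → Set
IsClique H R t c = AllPairs _≢_ c × All R c × AllPairs (Adj H t) c

module Submission where

-- Call a colour i an isolating colour of a list of vertices d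
-- if exactly one vertex x of d has colour i (i.e. lies in h i).  If every
-- nonempty sublist of a duplicate-free list c has an isolating colour, then
-- |c| ≤ k: isolate x by colour i, delete x, and recurse; the colours found
-- are pairwise distinct, because each later colour still meets the shrunken
-- list, which avoids colour i altogether.
--
-- For a clique of the co-occurrence graph, every nonempty sublist d has an
-- isolating colour: if d has a single vertex, any of its colours works;
-- otherwise min d and max d are adjacent, so some interval I contains both
-- (hence all of d) and t(I) ∈ {min d, max d} ⊆ d.  As h(part I) meets I only
-- in t(I), the colour part I isolates t(I) in d.

open import Defs
open import Data.Nat using (ℕ; _≤_; suc)
import Data.Nat.Properties as ℕ
open import Data.Fin using (Fin)
import Data.Fin as Fin
import Data.Fin.Properties as FinP
open import Data.Fin.Subset using (Subset; _∈_)
open import Data.Product using (_×_; _,_; ∃; ∃₂; ∃!; proj₁; proj₂)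
open import Data.Sum using (_⊎_; inj₁; inj₂)
open import Data.Empty using (⊥-elim)
open import Data.List using (List; []; _∷_; length; lookup; filter)
open import Data.List.Properties using (filter-all; filter-accept; filter-reject)
open import Data.List.Relation.Unary.All as All using (All; []; _∷_)
open import Data.List.Relation.Unary.AllPairs using (AllPairs; []; _∷_)
open import Data.List.Relation.Unary.Any using (here; there)
open import Data.List.Relation.Unary.Unique.Propositional using (Unique)
open import Data.List.Relation.Unary.Unique.Propositional.Properties
  using (filter⁺; Unique[x∷xs]⇒x∉xs)
open import Data.List.Membership.Propositional using () renaming (_∈_ to _∈ₗ_)
open import Data.List.Membership.Propositional.Properties using (∈-filter⁻; ∈-lookup)
open import Data.List.Relation.Binary.Subset.Propositional using (_⊆_)
import Data.List.Extrema
open import Relation.Binary.PropositionalEquality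
  using (_≡_; _≢_; refl; sym; trans; cong; subst)
open Relation.Binary.PropositionalEquality.≡-Reasoning
open import Relation.Binary.Definitions using (DecidableEquality)
open import Relation.Binary.Bundles using (TotalOrder)
open import Function.Base using (id)
open import Relation.Nullary using (¬?; Dec; yes; no)
open import Function.Definitions using (Injective; Surjective)

unique-lookup-injective : ∀ {A : Set} {xs : List A} → Unique xs → Injective _≡_ _≡_ (lookup xs)
unique-lookup-injective {xs = x ∷ xs} u {Fin.zero} {Fin.zero} _ = refl
unique-lookup-injective {xs = x ∷ xs} u {Fin.zero} {Fin.suc j} e =
  ⊥-elim (Unique[x∷xs]⇒x∉xs u (subst (_∈ₗ xs) (sym e) (∈-lookup j)))
unique-lookup-injective {xs = x ∷ xs} u {Fin.suc i} {Fin.zero} e =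
  ⊥-elim (Unique[x∷xs]⇒x∉xs u (subst (_∈ₗ xs) e (∈-lookup i)))
unique-lookup-injective {xs = x ∷ xs} (_ ∷ u) {Fin.suc i} {Fin.suc j} e =
  cong Fin.suc (unique-lookup-injective u e)

length-unique-fin : ∀ {k} {ps : List (Fin k)} → Unique ps → length ps ≤ k
length-unique-fin u = FinP.injective⇒≤ (unique-lookup-injective u)

allPairs-members : ∀ {A : Set} {P : A → A → Set} → (∀ {u v} → P u v → P v u) →
                   ∀ {c} → AllPairs P c → ∀ {u v} → u ∈ₗ c → v ∈ₗ c → u ≢ v → P u v
allPairs-members sym-P (_ ∷ _)  (here refl) (here refl) u≢v = ⊥-elim (u≢v refl)
allPairs-members sym-P (pc ∷ _) (here refl) (there v∈) _   = All.lookup pc v∈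
allPairs-members sym-P (pc ∷ _) (there u∈)  (here refl) _  = sym-P (All.lookup pc u∈)
allPairs-members sym-P (_ ∷ pc) (there u∈)  (there v∈) u≢v = allPairs-members sym-P pc u∈ v∈ u≢v

module Peeling {A : Set} (_≟_ : DecidableEquality A) {k : ℕ} (Colour : Fin k → A → Set) where

  ≢? : ∀ x y → Dec (y ≢ x)
  ≢? x y = ¬? (y ≟ x)

  remove : A → List A → List A
  remove x = filter (≢? x)

  remove-⊆ : ∀ {x d} → remove x d ⊆ d
  remove-⊆ {x} {d} y∈ = proj₁ (∈-filter⁻ (≢? x) {xs = d} y∈)

  remove-excludes : ∀ {x y d} → y ∈ₗ remove x d → y ≢ x
  remove-excludes {x} {y} {d} y∈ = proj₂ (∈-filter⁻ (≢? x) {xs = d} y∈)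

  length-remove : ∀ {x d} → Unique d → x ∈ₗ d → length d ≡ suc (length (remove x d))
  length-remove {x} {x ∷ d} (x∉d ∷ _) (here refl) = cong suc (begin
      length d                   ≡⟨ cong length (sym (filter-all (≢? x) (All.map ≢-sym x∉d))) ⟩
      length (remove x d)        ≡⟨ cong length (sym (filter-reject (≢? x) (λ x≢x → x≢x refl))) ⟩
      length (remove x (x ∷ d))  ∎)
    where
    ≢-sym : ∀ {y} → x ≢ y → y ≢ x
    ≢-sym x≢y y≡x = x≢y (sym y≡x)
  length-remove {x} {y ∷ d} (y∉d ∷ u) (there x∈d) = begin
      suc (length d)                  ≡⟨ cong suc (length-remove u x∈d) ⟩
      suc (suc (length (remove x d))) ≡⟨ cong (λ l → suc (length l))
                                             (sym (filter-accept (≢? x) (All.lookup y∉d x∈d))) ⟩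
      suc (length (remove x (y ∷ d))) ∎

  Isolates : Fin k → A → List A → Set
  Isolates i x d = x ∈ₗ d × Colour i x × (∀ {y} → y ∈ₗ d → Colour i y → y ≡ x)

  Meets : List A → Fin k → Set
  Meets d i = ∃ λ y → y ∈ₗ d × Colour i y

  isolated-colour-fresh : ∀ {i x d is} → Isolates i x d →
                          All (Meets (remove x d)) is → All (i ≢_) is
  isolated-colour-fresh {d = d} (_ , _ , only-x) = All.map λ where
    (y , y∈ , iy) refl → remove-excludes {d = d} y∈ (only-x (remove-⊆ {d = d} y∈) iy)

  meets-⊆ : ∀ {d d′ is} → d′ ⊆ d → All (Meets d′) is → All (Meets d) is
  meets-⊆ d′⊆d = All.map λ (y , y∈ , iy) → y , d′⊆d y∈ , iy

  module _ (c : List A)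
           (isolation : ∀ {x xs} → x ∷ xs ⊆ c → ∃₂ λ i y → Isolates i y (x ∷ xs)) where

    -- Peeling a sublist d of c yields as many distinct colours, each meeting d.
    -- The first argument is the length of d, driving the recursion.
    peel : ∀ r d → length d ≡ r → Unique d → d ⊆ c →
           ∃ λ is → Unique is × length d ≡ length is × All (Meets d) is
    peel _       []          _   _ _   = [] , [] , refl , []
    peel (suc r) d@(_ ∷ _)   len u d⊆c
      with i , x , iso@(x∈d , ix , _) ← isolation d⊆c
      with is , u-is , len-is , meets ←
             peel r (remove x d) (ℕ.suc-injective (trans (sym (length-remove u x∈d)) len))
                  (filter⁺ (≢? x) u) (λ y∈ → d⊆c (remove-⊆ y∈))
      = i ∷ is
      , isolated-colour-fresh iso meets ∷ u-is
      , trans (length-remove u x∈d) (cong suc len-is)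
      , (x , x∈d , ix) ∷ meets-⊆ remove-⊆ meets

    isolation-bound : Unique c → length c ≤ k
    isolation-bound u with is , u-is , len-is , _ ← peel (length c) c refl u (λ y∈ → y∈)
      = subst (_≤ k) (sym len-is) (length-unique-fin u-is)

module NonemptyExtrema {a ℓ₁ ℓ₂} (O : TotalOrder a ℓ₁ ℓ₂) where
  open TotalOrder O using () renaming (_≤_ to _≼_)
  open Data.List.Extrema O public using (min; max)
  open Data.List.Extrema O using (argmin-all; argmax-all; min≤⊤; min≤xs; ⊥≤max; xs≤max)

  min-∈ : ∀ x xs → min x xs ∈ₗ x ∷ xs
  min-∈ x xs = argmin-all id (here refl) (All.tabulate there)

  max-∈ : ∀ x xs → max x xs ∈ₗ x ∷ xs
  max-∈ x xs = argmax-all id (here refl) (All.tabulate there)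

  min-lower : ∀ {x xs y} → y ∈ₗ x ∷ xs → min x xs ≼ y
  min-lower {x} {xs} (here refl) = min≤⊤ x xs
  min-lower {x} {xs} (there y∈)  = All.lookup (min≤xs x xs) y∈

  max-upper : ∀ {x xs y} → y ∈ₗ x ∷ xs → y ≼ max x xs
  max-upper {x} {xs} (here refl) = ⊥≤max x xs
  max-upper {x} {xs} (there y∈)  = All.lookup (xs≤max x xs) y∈

adj-sym : ∀ {n m} (H : IntervalHypergraph n m) t {u v} → Adj H t u v → Adj H t v u
adj-sym H t (u≢v , j , u∈ , v∈ , inj₁ tj≡u) = (λ v≡u → u≢v (sym v≡u)) , j , v∈ , u∈ , inj₂ tj≡u
adj-sym H t (u≢v , j , u∈ , v∈ , inj₂ tj≡v) = (λ v≡u → u≢v (sym v≡u)) , j , v∈ , u∈ , inj₁ tj≡v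

module CliqueIsolation {n m k : ℕ} (H : IntervalHypergraph n m)
         (part : Fin m → Fin k) (h : Fin k → Subset n)
         (exact : ∀ j → ∃! _≡_ (λ v → (v ∈I IntervalHypergraph.ivs H j) × (v ∈ h (part j))))
         (t : Fin m → Fin n)
         (t-hits : ∀ j → (t j ∈I IntervalHypergraph.ivs H j) × (t j ∈ h (part j))) where

  open IntervalHypergraph H
  open Peeling FinP._≟_ (λ i v → v ∈ h i)
  open NonemptyExtrema (FinP.≤-totalOrder n)

  exact-hit : ∀ j {y} → y ∈I ivs j → y ∈ h (part j) → y ≡ t j
  exact-hit j y∈ yh with exact j
  ... | _ , _ , unique = trans (sym (unique (y∈ , yh))) (unique (t-hits j))

  spanning-interval-isolates : ∀ {d} j → (∀ {y} → y ∈ₗ d → y ∈I ivs j) → t j ∈ₗ d →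
                               Isolates (part j) (t j) d
  spanning-interval-isolates j inside tj∈d =
    tj∈d , proj₂ (t-hits j) , λ y∈d yh → exact-hit j (inside y∈d) yh

  interval-convex : ∀ {x xs y} j → min x xs ∈I ivs j → max x xs ∈I ivs j →
                    y ∈ₗ x ∷ xs → y ∈I ivs j
  interval-convex j (start≤min , _) (_ , max≤end) y∈ =
    FinP.≤-trans start≤min (min-lower y∈) , FinP.≤-trans (max-upper y∈) max≤end

  -- The isolation hypothesis of the peeling bound, for cliques: if min = max
  -- all members coincide and any colour of them isolates; otherwise the
  -- interval witnessing adjacency of min and max spans the list.
  clique-isolation : ∀ {c} → IsClique H (λ v → ∃ λ i → v ∈ h i) t c →
                     ∀ {x xs} → x ∷ xs ⊆ c → ∃₂ λ i y → Isolates i y (x ∷ xs)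
  clique-isolation {c} (_ , inR , adjacent) {x} {xs} d⊆c with min x xs FinP.≟ max x xs
  ... | yes min≡max with i , min∈hi ← All.lookup inR (d⊆c (min-∈ x xs)) =
    i , min x xs , min-∈ x xs , min∈hi ,
    λ y∈ _ → FinP.≤-antisym (subst (_ Fin.≤_) (sym min≡max) (max-upper y∈)) (min-lower y∈)
  ... | no min≢max
    with _ , j , min∈I , max∈I , tj≡ ← allPairs-members (adj-sym H t) adjacent
                                         (d⊆c (min-∈ x xs)) (d⊆c (max-∈ x xs)) min≢max =
    part j , t j , spanning-interval-isolates j (interval-convex j min∈I max∈I) (tj∈d tj≡)
    where
    tj∈d : (t j ≡ min x xs) ⊎ (t j ≡ max x xs) → t j ∈ₗ x ∷ xs
    tj∈d (inj₁ tj≡min) = subst (_∈ₗ x ∷ xs) (sym tj≡min) (min-∈ x xs)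
    tj∈d (inj₂ tj≡max) = subst (_∈ₗ x ∷ xs) (sym tj≡max) (max-∈ x xs)

lemma8 : ∀ {n m k : ℕ} (H : IntervalHypergraph n m)
    (part : Fin m → Fin k)
    → Surjective _≡_ _≡_ part
    → (h : Fin k → Subset n)
    → (∀ j → ∃! _≡_ (λ v → (v ∈I IntervalHypergraph.ivs H j) × (v ∈ h (part j))))
    → (t : Fin m → Fin n)
    → (∀ j → (t j ∈I IntervalHypergraph.ivs H j) × (t j ∈ h (part j)))
    → (c : List (Fin n))
    → IsClique H (λ v → ∃ λ i → v ∈ h i) t c
    → length c ≤ k
lemma8 H part _ h exact t t-hits c clique@(distinct , _ , _) =
  isolation-bound c (clique-isolation clique) distinct
  where
  open CliqueIsolation H part h exact t t-hits
  open Peeling FinP._≟_ (λ i v → v ∈ h i)
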